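{- Let $s+1\geq b\geq 0$ be integers. Let $Q=v_0,v_1,\ldots,v_{s+1}$ be a (graph) path with edges $e_i=v_iv_{i+1}$ for $0\le i\le s$, and let $I$ be a non-empty independent subset of $\{v_1,\ldots,v_s\}$ (no two vertices of $I$ consecutive on $Q$). If $B$ is a set of $b$ edges of $Q$ such that no edge in $B$ contains any vertex in $I$, then $|I|\leq \lceil (s-b)/2\rceil$. Moreover, if $|I|=\lceil (s-b)/2\rceil$ and $s-b$ is odd, then for every $1\leq i\leq s$, either $v_i\in I$, or $e_i\in B$, or $e_{i-1}\in B$, or $\{v_{i-1},v_{i+1}\}\subseteq I$. -}

module Defs where

open import Data.Nat using (ℕ; suc; _∸_; _/_)
open import Data.Fin using (Fin; zero; suc; inject₁; fromℕ)
open import Data.Fin.Subset using (Subset)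

-- The path Q = v_0, v_1, ..., v_{s+1}: vertex v_k is represented by k : Fin (s + 2).
Vertex : ℕ → Set
Vertex s = Fin (suc (suc s))

-- Edge e_i = v_i v_{i+1} (0 ≤ i ≤ s) is represented by i : Fin (s + 1).
Edge : ℕ → Set
Edge s = Fin (suc s)

left : ∀ {s} → Edge s → Vertex s
left i = inject₁ i

right : ∀ {s} → Edge s → Vertex s
right i = suc i

firstV : ∀ {s} → Vertex s
firstV = zero

lastV : ∀ {s} → Vertex s
lastV {s} = fromℕ (suc s)

-- Interior vertex v_i for 1 ≤ i ≤ s, indexed by j : Fin s with i = j + 1,
-- together with the neighbouring vertices / edges.
vI : ∀ {s} → Fin s → Vertex s
vI j = suc (inject₁ j)

vPrev : ∀ {s} → Fin s → Vertex s
vPrev j = inject₁ (inject₁ j)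

vNext : ∀ {s} → Fin s → Vertex s
vNext j = suc (suc j)

eI : ∀ {s} → Fin s → Edge s
eI j = suc j

ePrev : ∀ {s} → Fin s → Edge s
ePrev j = inject₁ j

-- ⌈(s - b)/2⌉ for integers with s + 1 ≥ b (so s - b ≥ -1):
-- equals ⌊(s + 1 - b)/2⌋, computed in ℕ.
ceilHalfDiff : ℕ → ℕ → ℕ
ceilHalfDiff s b = (suc s ∸ b) / 2

-- "s - b is odd" for s + 1 ≥ b: s - b = 2k - 1 for some k, i.e. s + 1 = b + 2k.
open import Data.Nat using (_+_; _*_)
open import Data.Product using (∃)
open import Relation.Binary.PropositionalEquality using (_≡_)

DiffOdd : ℕ → ℕ → Set
DiffOdd s b = ∃ λ k → suc s ≡ b + 2 * k

{-# OPTIONS --safe #-}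
-- Since I is independent and no edge of B touches I, every edge e_i is counted
-- exactly once by "an endpoint lies in I", "e_i ∈ B" or "e_i is uncovered".
-- Summing over the s + 1 edges, and using that each vertex of I is interior and
-- so lies on two edges, gives s + 1 = 2|I| + b + #uncovered.  This bounds |I| by
-- ⌊(s + 1 − b)/2⌋ = ⌈(s − b)/2⌉; if s − b is odd and the bound is attained, no
-- edge is uncovered, and at v_i the edges e_{i-1} and e_i are both covered.
module Submission where

open import Defs
open import Data.Nat using (ℕ; suc; zero; _≤_; _+_; _*_; _∸_; _/_)
open import Data.Nat.Properties
open import Data.Nat.DivMod using (m*n/n≡m; /-monoˡ-≤)
open import Data.Fin using (Fin; zero; suc; inject₁; fromℕ)
open import Data.Fin.Subset using (Subset; _∈_; _∉_; ∣_∣; Nonempty)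
open import Data.Vec using ([]; _∷_; lookup)
open import Data.Vec.Properties using (lookup⇒[]=)
open import Data.Vec.Functional using (Vector)
open import Data.Bool using (Bool; true; false; not; _∨_)
open import Data.Product using (_×_; _,_; proj₁; proj₂)
import Data.Product as Product
open import Data.Sum using (_⊎_; inj₁; inj₂)
import Data.Sum as Sum
open import Relation.Nullary using (¬_; contradiction)
open import Relation.Binary.PropositionalEquality
open import Algebra.Properties.CommutativeMonoid.Sum +-0-commutativeMonoid
  using (sum; sum-syntax; sum-cong-≗; sum-init-last; ∑-distrib-+)
open import Data.Nat.Solver using (module +-*-Solver)
open +-*-Solver using (solve; _:+_; _:=_)

indicator : Bool → ℕ
indicator true = 1
indicator false = 0

∉⇒indicator≡0 : ∀ {n} {p : Subset n} {i} → i ∉ p → indicator (lookup p i) ≡ 0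
∉⇒indicator≡0 {p = p} {i} i∉p with lookup p i in eq
... | true  = contradiction (lookup⇒[]= i p eq) i∉p
... | false = refl

∣p∣≡∑indicator : ∀ {n} (p : Subset n) → ∣ p ∣ ≡ ∑[ i < n ] indicator (lookup p i)
∣p∣≡∑indicator []          = refl
∣p∣≡∑indicator (true ∷ p)  = cong suc (∣p∣≡∑indicator p)
∣p∣≡∑indicator (false ∷ p) = ∣p∣≡∑indicator p

∑-ones : ∀ n → ∑[ i < n ] 1 ≡ n
∑-ones zero    = refl
∑-ones (suc n) = cong suc (∑-ones n)

∑≡0⇒≡0 : ∀ {n} (x : Vector ℕ n) → sum x ≡ 0 → ∀ i → x i ≡ 0
∑≡0⇒≡0 x ∑x≡0 zero    = m+n≡0⇒m≡0 (x zero) ∑x≡0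
∑≡0⇒≡0 x ∑x≡0 (suc i) = ∑≡0⇒≡0 (λ i → x (suc i)) (m+n≡0⇒n≡0 (x zero) ∑x≡0) i

-- Every interior vertex of a path lies on two edges, the end vertices on one.
∑-path-handshake : ∀ {n} (x : Vector ℕ (suc (suc n))) →
  x zero + ∑[ e < suc n ] (x (inject₁ e) + x (suc e)) + x (fromℕ (suc n)) ≡ 2 * sum x
∑-path-handshake {n} x = begin
  x₀ + ∑[ e < suc n ] (x (inject₁ e) + x (suc e)) + xₗ
    ≡⟨ cong (λ y → x₀ + y + xₗ) (∑-distrib-+ (λ e → x (inject₁ e)) (λ e → x (suc e))) ⟩
  x₀ + (∑init + ∑tail) + xₗ
    ≡⟨ solve 4 (λ a i t l → a :+ (i :+ t) :+ l := (i :+ l) :+ (a :+ t)) refl x₀ ∑init ∑tail xₗ ⟩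
  (∑init + xₗ) + (x₀ + ∑tail)
    ≡⟨ cong (_+ sum x) (sym (sum-init-last x)) ⟩
  sum x + sum x
    ≡⟨ cong (sum x +_) (sym (+-identityʳ (sum x))) ⟩
  2 * sum x
    ∎
  where
  open ≡-Reasoning
  x₀ = x zero
  xₗ = x (fromℕ (suc n))
  ∑init = ∑[ e < suc n ] x (inject₁ e)
  ∑tail = ∑[ e < suc n ] x (suc e)

[2*m]/2≡m : ∀ m → 2 * m / 2 ≡ m
[2*m]/2≡m m = trans (cong (_/ 2) (*-comm 2 m)) (m*n/n≡m m 2)

≤ceilHalfDiff : ∀ {s b} m → 2 * m + b ≤ suc s → m ≤ ceilHalfDiff s b
≤ceilHalfDiff m 2m+b≤ = subst (_≤ _) ([2*m]/2≡m m) (/-monoˡ-≤ 2 (m+n≤o⇒m≤o∸n (2 * m) 2m+b≤))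

ceilHalfDiff-odd : ∀ {s b} → ((k , _) : DiffOdd s b) → ceilHalfDiff s b ≡ k
ceilHalfDiff-odd {b = b} (k , s+1≡b+2k) = begin
  (suc _ ∸ b) / 2   ≡⟨ cong (λ n → (n ∸ b) / 2) s+1≡b+2k ⟩
  (b + 2 * k ∸ b) / 2 ≡⟨ cong (_/ 2) (m+n∸m≡n b (2 * k)) ⟩
  2 * k / 2           ≡⟨ [2*m]/2≡m k ⟩
  k                   ∎
  where open ≡-Reasoning

ceilHalfDiff-attained⇒slack≡0 : ∀ {s b m u} → suc s ≡ 2 * m + b + u →
  m ≡ ceilHalfDiff s b → DiffOdd s b → u ≡ 0
ceilHalfDiff-attained⇒slack≡0 {s} {b} {m} {u} counting m≡ odd@(k , s+1≡b+2k) =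
  +-cancelˡ-≡ (2 * k + b) u 0 (begin
    2 * k + b + u   ≡⟨ cong (λ n → 2 * n + b + u) (trans m≡ (ceilHalfDiff-odd {s} {b} odd)) ⟨
    2 * m + b + u   ≡⟨ counting ⟨
    suc s           ≡⟨ trans s+1≡b+2k (+-comm b (2 * k)) ⟩
    2 * k + b       ≡⟨ +-identityʳ _ ⟨
    2 * k + b + 0   ∎)
  where open ≡-Reasoning

uncovered : ∀ {s} → Subset (suc (suc s)) → Subset (suc s) → Edge s → Bool
uncovered I B e = not (lookup I (left e) ∨ lookup I (right e) ∨ lookup B e)

edge-weight≡1 : ∀ l r c → ¬ (l ≡ true × r ≡ true) → (c ≡ true → l ≢ true × r ≢ true) →
  indicator l + indicator r + indicator c + indicator (not (l ∨ r ∨ c)) ≡ 1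
edge-weight≡1 true  true  c     ¬lr _   = contradiction (refl , refl) ¬lr
edge-weight≡1 true  false true  _   c⇒¬ = contradiction refl (proj₁ (c⇒¬ refl))
edge-weight≡1 false true  true  _   c⇒¬ = contradiction refl (proj₂ (c⇒¬ refl))
edge-weight≡1 true  false false _   _   = refl
edge-weight≡1 false true  false _   _   = refl
edge-weight≡1 false false true  _   _   = refl
edge-weight≡1 false false false _   _   = refl

path-counting : ∀ {s} (I : Subset (suc (suc s))) (B : Subset (suc s)) →
  firstV {s} ∉ I → lastV {s} ∉ I →
  (∀ (e : Edge s) → ¬ (left e ∈ I × right e ∈ I)) →
  (∀ (e : Edge s) → e ∈ B → left e ∉ I × right e ∉ I) →
  suc s ≡ 2 * ∣ I ∣ + ∣ B ∣ + ∑[ e < suc s ] indicator (uncovered I B e)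
path-counting {s} I B first∉I last∉I independent B-avoids-I = begin
  suc s
    ≡⟨ sym (∑-ones (suc s)) ⟩
  ∑[ e < suc s ] 1
    ≡⟨ sym (sum-cong-≗ weight≡1) ⟩
  ∑[ e < suc s ] (inI (left e) + inI (right e) + inB e + unc e)
    ≡⟨ ∑-distrib-+ (λ e → inI (left e) + inI (right e) + inB e) unc ⟩
  ∑[ e < suc s ] (inI (left e) + inI (right e) + inB e) + ∑unc
    ≡⟨ cong (_+ ∑unc) (∑-distrib-+ (λ e → inI (left e) + inI (right e)) inB) ⟩
  ∑endpoints + sum inB + ∑unc
    ≡⟨ cong (λ y → y + sum inB + ∑unc) ∑endpoints≡2∣I∣ ⟩
  2 * ∣ I ∣ + sum inB + ∑unc
    ≡⟨ cong (λ y → 2 * ∣ I ∣ + y + ∑unc) (sym (∣p∣≡∑indicator B)) ⟩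
  2 * ∣ I ∣ + ∣ B ∣ + ∑unc
    ∎
  where
  open ≡-Reasoning
  inI : Vertex s → ℕ
  inI v = indicator (lookup I v)
  inB : Edge s → ℕ
  inB e = indicator (lookup B e)
  unc : Edge s → ℕ
  unc e = indicator (uncovered I B e)
  ∑unc : ℕ
  ∑unc = sum unc

  weight≡1 : ∀ e → inI (left e) + inI (right e) + inB e + unc e ≡ 1
  weight≡1 e = edge-weight≡1 _ _ _
    (λ (l , r) → independent e (lookup⇒[]= _ I l , lookup⇒[]= _ I r))
    (λ c → let l∉I , r∉I = B-avoids-I e (lookup⇒[]= e B c)
           in (λ l → l∉I (lookup⇒[]= _ I l)) , (λ r → r∉I (lookup⇒[]= _ I r)))

  ∑endpoints : ℕ
  ∑endpoints = ∑[ e < suc s ] (inI (left e) + inI (right e))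

  ∑endpoints≡2∣I∣ : ∑endpoints ≡ 2 * ∣ I ∣
  ∑endpoints≡2∣I∣ = begin
    ∑endpoints                            ≡⟨ +-identityʳ ∑endpoints ⟨
    0 + ∑endpoints + 0                    ≡⟨ cong₂ (λ a z → a + ∑endpoints + z)
                                                   (∉⇒indicator≡0 first∉I) (∉⇒indicator≡0 last∉I) ⟨
    inI firstV + ∑endpoints + inI lastV   ≡⟨ ∑-path-handshake inI ⟩
    2 * sum inI                           ≡⟨ cong (2 *_) (∣p∣≡∑indicator I) ⟨
    2 * ∣ I ∣                             ∎

both-covered : ∀ p v n c c′ →
  indicator (not (v ∨ n ∨ c)) ≡ 0 → indicator (not (p ∨ v ∨ c′)) ≡ 0 →
  v ≡ true ⊎ c ≡ true ⊎ c′ ≡ true ⊎ (p ≡ true × n ≡ true)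
both-covered p     true  n     c     c′    _  _  = inj₁ refl
both-covered p     false n     true  c′    _  _  = inj₂ (inj₁ refl)
both-covered p     false n     false true  _  _  = inj₂ (inj₂ (inj₁ refl))
both-covered true  false true  false false _  _  = inj₂ (inj₂ (inj₂ (refl , refl)))
both-covered p     false false false c′    () _
both-covered false false true  false false _  ()

lemma7p1 : (s b : ℕ) → b ≤ suc s →
    (I : Subset (suc (suc s))) → (B : Subset (suc s)) →
    firstV {s} ∉ I → lastV {s} ∉ I →
    (∀ (e : Edge s) → ¬ (left e ∈ I × right e ∈ I)) →
    Nonempty I →
    ∣ B ∣ ≡ b →
    (∀ (e : Edge s) → e ∈ B → left e ∉ I × right e ∉ I) →
    (∣ I ∣ ≤ ceilHalfDiff s b)
    × (∣ I ∣ ≡ ceilHalfDiff s b → DiffOdd s b →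
    ∀ (j : Fin s) →
    vI j ∈ I ⊎ eI j ∈ B ⊎ ePrev j ∈ B ⊎ (vPrev j ∈ I × vNext j ∈ I))
lemma7p1 s b _ I B first∉I last∉I independent _ refl B-avoids-I = bound , tight
  where
  counting : suc s ≡ 2 * ∣ I ∣ + b + ∑[ e < suc s ] indicator (uncovered I B e)
  counting = path-counting I B first∉I last∉I independent B-avoids-I
  bound : ∣ I ∣ ≤ ceilHalfDiff s b
  bound = ≤ceilHalfDiff ∣ I ∣ (subst (2 * ∣ I ∣ + b ≤_) (sym counting) (m≤m+n _ _))
  tight : ∣ I ∣ ≡ ceilHalfDiff s b → DiffOdd s b → ∀ (j : Fin s) →
    vI j ∈ I ⊎ eI j ∈ B ⊎ ePrev j ∈ B ⊎ (vPrev j ∈ I × vNext j ∈ I)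
  tight ∣I∣≡ odd j =
    Sum.map (lookup⇒[]= _ I) (Sum.map (lookup⇒[]= _ B) (Sum.map (lookup⇒[]= _ B)
      (Product.map (lookup⇒[]= _ I) (lookup⇒[]= _ I))))
      (both-covered (lookup I (vPrev j)) (lookup I (vI j)) (lookup I (vNext j)) (lookup B (eI j))
                    (lookup B (ePrev j)) (none-uncovered (eI j)) (none-uncovered (ePrev j)))
    where
    none-uncovered : ∀ e → indicator (uncovered I B e) ≡ 0
    none-uncovered = ∑≡0⇒≡0 (λ e → indicator (uncovered I B e))
                            (ceilHalfDiff-attained⇒slack≡0 counting ∣I∣≡ odd)
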